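{- Let $k\ge 1$ be an integer and $p$ a prime with $p\le k$. Then $$a_p(k)=e_p(k)+\lfloor \log_p k\rfloor .$$
   Context: For a prime $p$ and integer $m$, $\nu_p(m)$ denotes the largest $r$ with $p^r\mid m$, with the convention $\nu_p(0)=\infty$. Let $e_p(k)=\nu_p(k!)$. For integers $n$ define $f_{p,k}(n)=\sum_{j=0}^{k-1}\nu_p(n-j)=\nu_p\big(n(n-1)\cdots(n-k+1)\big)$. Define $a_p(k)$ to be the smallest integer $m\ge 0$ such that whether or not $f_{p,k}(n)\ge 2e_p(k)$ holds depends only on the congruence class of $n$ modulo $p^m$. -}

module Defs where

open import Data.Nat using (ℕ; zero; suc; _+_; _*_; _^_; _≤_; _<_; _!)
open import Data.Nat.Divisibility using () renaming (_∣_ to _∣ℕ_)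
import Data.Integer as ℤ
open import Data.Integer using (ℤ; +_)
open import Data.Integer.Divisibility using (_∣_)
open import Data.Product using (_×_)
open import Relation.Nullary using (¬_)
open import Function.Bundles using (_⇔_)

-- ν_p(m) = r  :  r is the largest exponent with p^r ∣ m  (m ≠ 0 case;
-- used for m = k! ≥ 1).
IsVal : ℕ → ℕ → ℕ → Set
IsVal p m r = (p ^ r ∣ℕ m) × ¬ (p ^ suc r ∣ℕ m)

IsEp : ℕ → ℕ → ℕ → Set
IsEp p k e = IsVal p (k !) e

IsFloorLog : ℕ → ℕ → ℕ → Set
IsFloorLog p k L = (p ^ L ≤ k) × (k < p ^ suc L)

falling : ℤ → ℕ → ℤ
falling n zero    = + 1
falling n (suc k) = falling n k ℤ.* (n ℤ.- + k)

-- f_{p,k}(n) ≥ t, i.e. ν_p(n(n-1)…(n-k+1)) ≥ t (with ν_p(0) = ∞),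
-- which by definition of ν_p means p^t ∣ n(n-1)…(n-k+1).
FGe : ℕ → ℕ → ℤ → ℕ → Set
FGe p k n t = (+ (p ^ t)) ∣ falling n k

Cond : ℕ → ℕ → ℕ → ℤ → Set
Cond p k e n = FGe p k n (2 * e)

_≡[mod_]_ : ℤ → ℕ → ℤ → Set
n ≡[mod q ] n' = (+ q) ∣ (n ℤ.- n')

DependsOnlyMod : ℕ → ℕ → ℕ → ℕ → Set
DependsOnlyMod p k e m =
  ∀ (n n' : ℤ) → n ≡[mod p ^ m ] n' → (Cond p k e n ⇔ Cond p k e n')

IsAp : ℕ → ℕ → ℕ → ℕ → Set
IsAp p k e a = DependsOnlyMod p k e a × (∀ m → m < a → ¬ DependsOnlyMod p k e m)

module Submission where

-- Let e = ν_p(k!), p^L ≤ k < p^{L+1} and M = e + L.  Whenever k = j + 1 + r,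
-- (n)_k = (n)_j · (n - j) · (n-j-1)_r, and if n ≡ j (mod p^M) the outer
-- blocks are congruent to j! and ±r! modulo p^M.
-- Upper bound: if p^M ∣ n - j for some j < k, then ν((n)_k) ≥ ν(j!) + M + ν(r!),
-- which is ≥ 2e because Legendre's formula ν(c!) = Σ_i ⌊c/p^i⌋ loses at most
-- one carry per digit (e ≤ L + ν(j!) + ν(r!)); this persists modulo p^M.
-- Otherwise every factor n - j has valuation below M, unchanged modulo p^M,
-- so ν((n)_k) itself depends only on n mod p^M.
-- Lower bound: for j = p^L - 1 Legendre gives e = L + ν(j!) + ν(r!) exactly,
-- so n = j + p^{M-1} ≡ j has ν((n)_k) = 2e - 1, while (j)_k = 0.
-- The file develops congruences and falling factorials over ℤ, p-adic
-- valuations, Legendre's formula, the valuation of (n)_k near and far from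
-- its roots, the two bounds, and then the theorem.

open import Defs
open import Data.Nat using (ℕ; _+_; _≤_)
open import Data.Nat.Primality using (Prime)

open import Data.Nat using (zero; suc; _*_; _∸_; _^_; _<_; _!; pred; z≤n; s≤s; z<s; NonZero; >-nonZero⁻¹; nonTrivial⇒n>1; _≤?_; _<?_)
open import Data.Nat.Properties
open import Data.Nat.DivMod
  using (_/_; _%_; m≡m%n+[m/n]*n; m%n<n; m*n/n≡m; m<n⇒m/n≡0; 0/n≡0; /-monoˡ-≤; +-distrib-/-∣ˡ; +-distrib-/-∣ʳ; m<n*o⇒m/o<n)
open import Data.Nat.Divisibility
  using (divides; divides-refl; _∣?_; ∣-refl; ∣-trans; _∣0; ∣⇒≤; *-pres-∣; *-cancelˡ-∣)
  renaming (_∣_ to _∣ℕ_)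
open import Data.Nat.Primality using (prime⇒nonZero; prime⇒nonTrivial; euclidsLemma)
open import Data.Nat.Induction using (<-rec)
open import Data.Integer as ℤ using (ℤ; +_; -[1+_]; ∣_∣; _-_)
import Data.Integer.Properties as ℤP
open import Data.Integer.Divisibility using (_∣_)
import Data.Integer.Divisibility.Signed as Signed
import Data.Nat.Tactic.RingSolver as ℕ-Ring
import Data.Integer.Tactic.RingSolver as ℤ-Ring
open import Data.Product using (_×_; _,_; proj₁; ∃-syntax)
open import Data.Sum using ([_,_])
open import Data.Empty using (⊥-elim)
open import Relation.Nullary using (¬_; yes; no)
open import Relation.Binary.PropositionalEquality
  using (_≡_; refl; sym; trans; cong; cong₂; subst; subst₂; module ≡-Reasoning)
open import Function.Bundles using (mk⇔; Equivalence)

∣-diff-sym : ∀ q x y → q ∣ x - y → q ∣ y - x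
∣-diff-sym q x y = subst (∣ q ∣ ∣ℕ_) (ℤP.∣i-j∣≡∣j-i∣ x y)

∣-diff-trans : ∀ q x y z → q ∣ x - y → q ∣ y - z → q ∣ x - z
∣-diff-trans q x y z x≡y y≡z =
  Signed.∣⇒∣ᵤ {q} {x - z}
    (subst (Signed._∣_ q) (chain x y z)
      (Signed.∣m∣n⇒∣m+n {q} {x - y} {y - z} (Signed.∣ᵤ⇒∣ {q} {x - y} x≡y) (Signed.∣ᵤ⇒∣ {q} {y - z} y≡z)))
  where
  chain : ∀ x y z → (x - y) ℤ.+ (y - z) ≡ x - z
  chain = ℤ-Ring.solve-∀

∣-transfer : ∀ q x y → q ∣ x - y → q ∣ x → q ∣ y
∣-transfer q x y x≡y q∣x =
  Signed.∣⇒∣ᵤ {q} {y}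
    (subst (Signed._∣_ q) (cancel x y)
      (Signed.∣m∣n⇒∣m-n {q} {x} {x - y} (Signed.∣ᵤ⇒∣ {q} {x} q∣x) (Signed.∣ᵤ⇒∣ {q} {x - y} x≡y)))
  where
  cancel : ∀ x y → x - (x - y) ≡ y
  cancel = ℤ-Ring.solve-∀

[a+b]-a≡b : ∀ a b → (a ℤ.+ b) - a ≡ b
[a+b]-a≡b = ℤ-Ring.solve-∀

falling-+ : ∀ n a b → falling n (a + b) ≡ falling n a ℤ.* falling (n - + a) b
falling-+ n a zero rewrite +-identityʳ a = sym (ℤP.*-identityʳ (falling n a))
falling-+ n a (suc b) rewrite +-suc a b =
  trans (cong₂ ℤ._*_ (falling-+ n a b) (cong (n -_) (ℤP.pos-+ a b)))
        (regroup (falling n a) (falling (n - + a) b) n (+ a) (+ b))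
  where
  regroup : ∀ A B n a b → A ℤ.* B ℤ.* (n - (a ℤ.+ b)) ≡ A ℤ.* (B ℤ.* ((n - a) - b))
  regroup = ℤ-Ring.solve-∀

falling-suc : ∀ x r → falling x (suc r) ≡ x ℤ.* falling (x - + 1) r
falling-suc x r = trans (falling-+ x 1 r) (cong (ℤ._* falling (x - + 1) r) top)
  where
  top : falling x 1 ≡ x
  top = trans (ℤP.*-identityˡ (x - + 0)) (ℤP.+-identityʳ x)

falling-around : ∀ n j r →
  falling n (j + suc r) ≡ falling n j ℤ.* ((n - + j) ℤ.* falling ((n - + j) - + 1) r)
falling-around n j r = trans (falling-+ n j (suc r)) (cong (falling n j ℤ.*_) (falling-suc (n - + j) r))

falling-root : ∀ j r → falling (+ j) (j + suc r) ≡ + 0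
falling-root j r = begin
  falling (+ j) (j + suc r)                                      ≡⟨ falling-around (+ j) j r ⟩
  falling (+ j) j ℤ.* ((+ j - + j) ℤ.* falling ((+ j - + j) - + 1) r)
    ≡⟨ cong (λ z → falling (+ j) j ℤ.* (z ℤ.* falling (z - + 1) r)) (ℤP.+-inverseʳ (+ j)) ⟩
  falling (+ j) j ℤ.* + 0                                        ≡⟨ ℤP.*-zeroʳ (falling (+ j) j) ⟩
  + 0                                                            ∎
  where open ≡-Reasoning

falling-self : ∀ c → falling (+ c) c ≡ + (c !)
falling-self zero    = refl
falling-self (suc c) = begin
  falling (+ suc c) (suc c)             ≡⟨ falling-suc (+ suc c) c ⟩
  + suc c ℤ.* falling (+ c) c           ≡⟨ cong (+ suc c ℤ.*_) (falling-self c) ⟩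
  + suc c ℤ.* + (c !)                   ≡⟨ sym (ℤP.pos-* (suc c) (c !)) ⟩
  + (suc c !)                           ∎
  where open ≡-Reasoning

falling-minus-one : ∀ r → ∣ falling -[1+ 0 ] r ∣ ≡ r !
falling-minus-one zero    = refl
falling-minus-one (suc r) = begin
  ∣ falling -[1+ 0 ] r ℤ.* (-[1+ 0 ] - + r) ∣        ≡⟨ ℤP.abs-* (falling -[1+ 0 ] r) (-[1+ 0 ] - + r) ⟩
  ∣ falling -[1+ 0 ] r ∣ * ∣ -[1+ 0 ] - + r ∣       ≡⟨ cong₂ _*_ (falling-minus-one r) (abs-shift r) ⟩
  r ! * suc r                                       ≡⟨ *-comm (r !) (suc r) ⟩
  suc r !                                           ∎
  where
  open ≡-Reasoning
  abs-shift : ∀ r → ∣ -[1+ 0 ] - + r ∣ ≡ suc r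
  abs-shift zero    = refl
  abs-shift (suc r) = refl

falling-cong : ∀ q x y m → q ∣ x - y → q ∣ falling x m - falling y m
falling-cong q x y zero _ = ∣ q ∣ ∣0
falling-cong q x y (suc m) x≡y =
  Signed.∣⇒∣ᵤ {q} {falling x (suc m) - falling y (suc m)}
    (subst (Signed._∣_ q) (sym (expand (falling x m) (falling y m) x y (+ m)))
      (Signed.∣m∣n⇒∣m+n {q} {(falling x m - falling y m) ℤ.* (x - + m)} {falling y m ℤ.* (x - y)}
        (Signed.∣m⇒∣m*n {q} {falling x m - falling y m} (x - + m)
          (Signed.∣ᵤ⇒∣ {q} {falling x m - falling y m} (falling-cong q x y m x≡y)))
        (Signed.∣n⇒∣m*n {q} (falling y m) {x - y} (Signed.∣ᵤ⇒∣ {q} {x - y} x≡y))))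
  where
  expand : ∀ fx fy x y c → fx ℤ.* (x - c) - fy ℤ.* (y - c) ≡ (fx - fy) ℤ.* (x - c) ℤ.+ fy ℤ.* (x - y)
  expand = ℤ-Ring.solve-∀

-- p-adic valuations.  IsVal p x w (Defs) says ν_p(x) = w; for x = 0 it is
-- never inhabited.

^-∣-^ : ∀ p {a b} → a ≤ b → p ^ a ∣ℕ p ^ b
^-∣-^ p {a} {b} a≤b = divides (p ^ (b ∸ a)) (begin
  p ^ b                 ≡⟨ cong (p ^_) (sym (m+[n∸m]≡n a≤b)) ⟩
  p ^ (a + (b ∸ a))     ≡⟨ ^-distribˡ-+-* p a (b ∸ a) ⟩
  p ^ a * p ^ (b ∸ a)   ≡⟨ *-comm (p ^ a) (p ^ (b ∸ a)) ⟩
  p ^ (b ∸ a) * p ^ a   ∎)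
  where open ≡-Reasoning

^-∣-weaken : ∀ p {a b x} → a ≤ b → p ^ b ∣ℕ x → p ^ a ∣ℕ x
^-∣-weaken p a≤b = ∣-trans (^-∣-^ p a≤b)

val-≥ : ∀ {p x w t} → IsVal p x w → p ^ t ∣ℕ x → t ≤ w
val-≥ {p} {x} {w} {t} (_ , maximal) p^t∣x with t ≤? w
... | yes t≤w = t≤w
... | no  t≰w = ⊥-elim (maximal (^-∣-weaken p (≰⇒> t≰w) p^t∣x))

val-unique : ∀ {p x v w} → IsVal p x v → IsVal p x w → v ≡ w
val-unique v-val w-val = ≤-antisym (val-≥ w-val (proj₁ v-val)) (val-≥ v-val (proj₁ w-val))

val-same-∣ : ∀ {p x y} w t → IsVal p x w → IsVal p y w → p ^ t ∣ℕ x → p ^ t ∣ℕ y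
val-same-∣ {p} w t x-val y-val p^t∣x = ^-∣-weaken p (val-≥ {w = w} {t = t} x-val p^t∣x) (proj₁ y-val)

val-coprime : ∀ {p x} → ¬ p ∣ℕ x → IsVal p x 0
val-coprime {p} {x} p∤x = divides x (sym (*-identityʳ x)) , λ p∣x → p∤x (subst (_∣ℕ x) (*-identityʳ p) p∣x)

module PrimeValuation {p : ℕ} (p-prime : Prime p) where

  instance
    p≢0 : NonZero p
    p≢0 = prime⇒nonZero p-prime

  p>1 : 1 < p
  p>1 = nonTrivial⇒n>1 p {{prime⇒nonTrivial p-prime}}

  val-one : IsVal p 1 0
  val-one = val-coprime (λ p∣1 → <⇒≱ p>1 (∣⇒≤ p∣1))

  -- ν_p is additive on products (this is where primality is used, via
  -- Euclid's lemma on the p-free parts).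
  val-* : ∀ {x y} v w → IsVal p x v → IsVal p y w → IsVal p (x * y) (v + w)
  val-* {x} {y} v w (divides a x≡a*p^v , x-max) (divides b y≡b*p^w , y-max) =
    divides (a * b) xy≡ , p^[v+w+1]∤xy
    where
    p∤a : ¬ p ∣ℕ a
    p∤a p∣a = x-max (subst (p * p ^ v ∣ℕ_) (sym x≡a*p^v) (*-pres-∣ p∣a ∣-refl))
    p∤b : ¬ p ∣ℕ b
    p∤b p∣b = y-max (subst (p * p ^ w ∣ℕ_) (sym y≡b*p^w) (*-pres-∣ p∣b ∣-refl))
    regroup : ∀ a b P Q → (a * P) * (b * Q) ≡ (a * b) * (P * Q)
    regroup = ℕ-Ring.solve-∀
    xy≡ : x * y ≡ (a * b) * p ^ (v + w)
    xy≡ = begin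
      x * y                           ≡⟨ cong₂ _*_ x≡a*p^v y≡b*p^w ⟩
      (a * p ^ v) * (b * p ^ w)       ≡⟨ regroup a b (p ^ v) (p ^ w) ⟩
      (a * b) * (p ^ v * p ^ w)       ≡⟨ cong ((a * b) *_) (sym (^-distribˡ-+-* p v w)) ⟩
      (a * b) * p ^ (v + w)           ∎
      where open ≡-Reasoning
    p^[v+w+1]∤xy : ¬ p ^ suc (v + w) ∣ℕ x * y
    p^[v+w+1]∤xy h = [ p∤a , p∤b ] (euclidsLemma a b p-prime
      (*-cancelˡ-∣ (p ^ (v + w)) {{m^n≢0 p (v + w)}}
        (subst₂ _∣ℕ_ (*-comm p (p ^ (v + w))) (trans xy≡ (*-comm (a * b) _)) h)))

  val-pow : ∀ N → IsVal p (p ^ N) N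
  val-pow N = ∣-refl , λ h → <⇒≱ p^N<p^[N+1] (∣⇒≤ {{m^n≢0 p N}} h)
    where
    p^N<p^[N+1] : p ^ N < p ^ suc N
    p^N<p^[N+1] = subst (p ^ N <_) (*-comm (p ^ N) p) (m<m*n (p ^ N) p {{m^n≢0 p N}} p>1)

  val-p : IsVal p p 1
  val-p = subst (λ x → IsVal p x 1) (*-identityʳ p) (val-pow 1)

  val-exists : ∀ x → 0 < x → ∃[ w ] IsVal p x w
  val-exists = <-rec (λ x → 0 < x → ∃[ w ] IsVal p x w) step
    where
    step : ∀ x → (∀ {y} → y < x → 0 < y → ∃[ w ] IsVal p y w) → 0 < x → ∃[ w ] IsVal p x w
    step x rec x>0 with p ∣? x
    ... | no p∤x = 0 , val-coprime p∤x
    ... | yes (divides zero x≡0) = ⊥-elim (<⇒≢ x>0 (sym x≡0))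
    ... | yes (divides q@(suc _) x≡q*p) with rec (subst (q <_) (sym x≡q*p) (m<m*n q p p>1)) z<s
    ...   | w , q-val = suc w , subst₂ (IsVal p) (sym x≡q*p) (+-comm w 1) (val-* w 1 q-val val-p)

  val-below : ∀ M x → ¬ p ^ M ∣ℕ x → ∃[ w ] w < M × IsVal p x w
  val-below M zero p^M∤0 = ⊥-elim (p^M∤0 ((p ^ M) ∣0))
  val-below M x@(suc _) p^M∤x with val-exists x z<s
  ... | w , x-val with w <? M
  ...   | yes w<M = w , w<M , x-val
  ...   | no  w≮M = ⊥-elim (p^M∤x (^-∣-weaken p (≮⇒≥ w≮M) (proj₁ x-val)))

  decompose : ∀ c → c ≡ c % p + c / p * p
  decompose c = m≡m%n+[m/n]*n c p

  [r+q*p]/p≡q : ∀ {r} q → r < p → (r + q * p) / p ≡ q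
  [r+q*p]/p≡q {r} q r<p =
    trans (+-distrib-/-∣ʳ r (divides-refl q)) (cong₂ _+_ (m<n⇒m/n≡0 r<p) (m*n/n≡m q p))

  <[1+m/p]*p : ∀ m → m < suc (m / p) * p
  <[1+m/p]*p m = begin-strict
    m                   ≡⟨ decompose m ⟩
    m % p + m / p * p   <⟨ +-monoˡ-< (m / p * p) (m%n<n m p) ⟩
    p + m / p * p       ∎
    where open ≤-Reasoning

  pred[p]<p : pred p < p
  pred[p]<p = subst (pred p <_) (suc-pred p) (n<1+n (pred p))

  pred[suc-t*p] : ∀ t → pred (suc t * p) ≡ pred p + t * p
  pred[suc-t*p] t = cong (λ z → pred (z + t * p)) (sym (suc-pred p))

  /-suc-coprime : ∀ c → ¬ p ∣ℕ suc c → suc c / p ≡ c / p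
  /-suc-coprime c p∤c+1 with suc (c % p) <? p
  ... | yes c%p+1<p = trans (cong (λ z → suc z / p) (decompose c)) ([r+q*p]/p≡q (c / p) c%p+1<p)
  ... | no  c%p+1≮p = ⊥-elim (p∤c+1 (divides (suc (c / p)) (begin
      suc c                     ≡⟨ cong suc (decompose c) ⟩
      suc (c % p) + c / p * p   ≡⟨ cong (_+ c / p * p) (≤-antisym (m%n<n c p) (≮⇒≥ c%p+1≮p)) ⟩
      p + c / p * p             ∎)))
    where open ≡-Reasoning

  [1+a+b]/p≤ : ∀ a b → suc (a + b) / p ≤ suc (a / p + b / p)
  [1+a+b]/p≤ a b = ≤-pred (m<n*o⇒m/o<n (begin-strict
    suc a + b                              ≤⟨ +-monoˡ-≤ b (<[1+m/p]*p a) ⟩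
    suc (a / p) * p + b                    <⟨ +-monoʳ-< (suc (a / p) * p) (<[1+m/p]*p b) ⟩
    suc (a / p) * p + suc (b / p) * p      ≡⟨ regroup (a / p) (b / p) p ⟩
    suc (suc (a / p + b / p)) * p          ∎))
    where
    open ≤-Reasoning
    regroup : ∀ x y p → suc x * p + suc y * p ≡ suc (suc (x + y)) * p
    regroup = ℕ-Ring.solve-∀

  -- Legendre's sum  legendre f c = ⌊c/p⌋ + ⌊c/p²⌋ + ⋯ + ⌊c/p^f⌋, using
  -- ⌊⌊c/p⌋/p^i⌋ = ⌊c/p^{i+1}⌋.
  legendre : ℕ → ℕ → ℕ
  legendre zero    c = 0
  legendre (suc f) c = c / p + legendre f (c / p)

  legendre-mono : ∀ f {c d} → c ≤ d → legendre f c ≤ legendre f d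
  legendre-mono zero    _   = z≤n
  legendre-mono (suc f) c≤d = +-mono-≤ (/-monoˡ-≤ p c≤d) (legendre-mono f (/-monoˡ-≤ p c≤d))

  -- At most one carry per digit: legendre f (a+b+1) ≤ f + legendre f a + legendre f b.
  legendre-subadditive : ∀ f a b → legendre f (suc (a + b)) ≤ f + legendre f a + legendre f b
  legendre-subadditive zero    a b = z≤n
  legendre-subadditive (suc f) a b = begin
    q + legendre f q                                        ≤⟨ +-mono-≤ q≤Q (legendre-mono f q≤Q) ⟩
    Q + legendre f Q                                        ≤⟨ +-monoʳ-≤ Q (legendre-subadditive f a′ b′) ⟩
    Q + (f + legendre f a′ + legendre f b′)                 ≡⟨ regroup a′ b′ f (legendre f a′) (legendre f b′) ⟩
    suc f + (a′ + legendre f a′) + (b′ + legendre f b′)     ∎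
    where
    open ≤-Reasoning
    a′ = a / p
    b′ = b / p
    q = suc (a + b) / p
    Q = suc (a′ + b′)
    q≤Q : q ≤ Q
    q≤Q = [1+a+b]/p≤ a b
    regroup : ∀ x y f u v → suc (x + y) + (f + u + v) ≡ suc f + (x + u) + (y + v)
    regroup = ℕ-Ring.solve-∀

  legendre-pow : ∀ f y → legendre f (p ^ f + y) ≡ f + legendre f (pred (p ^ f)) + legendre f y
  legendre-pow zero    y = refl
  legendre-pow (suc f) y = begin
    (p ^ suc f + y) / p + legendre f ((p ^ suc f + y) / p)
      ≡⟨ cong (λ z → z + legendre f z) top ⟩
    (p ^ f + y′) + legendre f (p ^ f + y′)
      ≡⟨ cong (λ z → (p ^ f + y′) + z) (legendre-pow f y′) ⟩
    (p ^ f + y′) + (f + legendre f t + legendre f y′)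
      ≡⟨ cong (λ z → (z + y′) + (f + legendre f t + legendre f y′)) (sym p^f≡suc-t) ⟩
    (suc t + y′) + (f + legendre f t + legendre f y′)
      ≡⟨ regroup t y′ f (legendre f t) (legendre f y′) ⟩
    suc f + (t + legendre f t) + (y′ + legendre f y′)
      ≡⟨ cong (λ z → suc f + (z + legendre f z) + (y′ + legendre f y′)) (sym rest) ⟩
    suc f + (pred (p ^ suc f) / p + legendre f (pred (p ^ suc f) / p)) + (y′ + legendre f y′) ∎
    where
    open ≡-Reasoning
    y′ = y / p
    t = pred (p ^ f)
    p^f≡suc-t : suc t ≡ p ^ f
    p^f≡suc-t = suc-pred (p ^ f) {{m^n≢0 p f}}
    p*p^f≡ : p * p ^ f ≡ suc t * p
    p*p^f≡ = trans (*-comm p (p ^ f)) (cong (_* p) (sym p^f≡suc-t))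
    top : (p ^ suc f + y) / p ≡ p ^ f + y′
    top = trans (+-distrib-/-∣ˡ y (divides (p ^ f) (*-comm p (p ^ f))))
                (cong (_+ y′) (trans (cong (_/ p) (*-comm p (p ^ f))) (m*n/n≡m (p ^ f) p)))
    rest : pred (p ^ suc f) / p ≡ t
    rest = trans (cong (λ z → pred z / p) p*p^f≡) (trans (cong (_/ p) (pred[suc-t*p] t)) ([r+q*p]/p≡q t pred[p]<p))
    regroup : ∀ t y f u v → (suc t + y) + (f + u + v) ≡ suc f + (t + u) + (y + v)
    regroup = ℕ-Ring.solve-∀

  -- One step of Legendre's formula: ν_p(c!) = ⌊c/p⌋ + ν_p(⌊c/p⌋!), as the
  -- multiples p, 2p, …, ⌊c/p⌋p of p up to c contribute p^⌊c/p⌋ · ⌊c/p⌋!.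
  val-factorial-step : ∀ c {w} → IsVal p ((c / p) !) w → IsVal p (c !) (c / p + w)
  val-factorial-step zero {w} =
    subst (λ q → IsVal p (q !) w → IsVal p (0 !) (q + w)) (sym (0/n≡0 p)) (λ h → h)
  val-factorial-step (suc c) {w} h with p ∣? suc c
  ... | no p∤c+1 =
    subst (IsVal p (suc c !)) (cong (_+ w) (sym quotient-same))
      (val-* 0 (c / p + w) (val-coprime p∤c+1)
        (val-factorial-step c (subst (λ q → IsVal p (q !) w) quotient-same h)))
    where
    quotient-same : suc c / p ≡ c / p
    quotient-same = /-suc-coprime c p∤c+1
  ... | yes (divides zero ())
  ... | yes (divides (suc q) c+1≡[q+1]p) with val-exists (suc q) z<s | val-exists (q !) (>-nonZero⁻¹ (q !) {{q !≢0}})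
  ...   | v , q+1-val | w′ , q!-val =
    subst (IsVal p (suc c !)) total (val-* (suc v) (c / p + w′) c+1-val c!-val)
    where
    open ≡-Reasoning
    [c+1]/p≡ : suc c / p ≡ suc q
    [c+1]/p≡ = trans (cong (_/ p) c+1≡[q+1]p) (m*n/n≡m (suc q) p)
    c/p≡ : c / p ≡ q
    c/p≡ = trans (cong (λ z → pred z / p) c+1≡[q+1]p) (trans (cong (_/ p) (pred[suc-t*p] q)) ([r+q*p]/p≡q q pred[p]<p))
    c+1-val : IsVal p (suc c) (suc v)
    c+1-val = subst₂ (IsVal p) (sym c+1≡[q+1]p) (+-comm v 1) (val-* v 1 q+1-val val-p)
    c!-val : IsVal p (c !) (c / p + w′)
    c!-val = val-factorial-step c (subst (λ z → IsVal p (z !) w′) (sym c/p≡) q!-val)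
    w≡ : w ≡ v + w′
    w≡ = val-unique (subst (λ z → IsVal p (z !) w) [c+1]/p≡ h) (val-* v w′ q+1-val q!-val)
    regroup : ∀ v q w → suc v + (q + w) ≡ suc q + (v + w)
    regroup = ℕ-Ring.solve-∀
    total : suc v + (c / p + w′) ≡ suc c / p + w
    total = begin
      suc v + (c / p + w′)    ≡⟨ cong (λ z → suc v + (z + w′)) c/p≡ ⟩
      suc v + (q + w′)        ≡⟨ regroup v q w′ ⟩
      suc q + (v + w′)        ≡⟨ cong₂ _+_ (sym [c+1]/p≡) (sym w≡) ⟩
      suc c / p + w           ∎

  legendre-formula : ∀ f c → c < p ^ suc f → IsVal p (c !) (legendre f c)
  legendre-formula zero c c<p =
    subst (IsVal p (c !)) (trans (+-identityʳ (c / p)) c/p≡0)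
      (val-factorial-step c (subst (λ q → IsVal p (q !) 0) (sym c/p≡0) val-one))
    where
    c/p≡0 : c / p ≡ 0
    c/p≡0 = m<n⇒m/n≡0 (subst (c <_) (*-identityʳ p) c<p)
  legendre-formula (suc f) c c<p^[f+2] =
    val-factorial-step c (legendre-formula f (c / p) (m<n*o⇒m/o<n (subst (c <_) (*-comm p (p ^ suc f)) c<p^[f+2])))

  IsValℤ : ℤ → ℕ → Set
  IsValℤ x w = IsVal p ∣ x ∣ w

  ^-∣-transfer : ∀ w N x y → w ≤ N → + (p ^ N) ∣ x - y → + (p ^ w) ∣ x → + (p ^ w) ∣ y
  ^-∣-transfer w N x y w≤N x≡y = ∣-transfer (+ (p ^ w)) x y (^-∣-weaken p w≤N x≡y)

  val-transfer : ∀ w N x y → w < N → + (p ^ N) ∣ x - y → IsValℤ x w → IsValℤ y w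
  val-transfer w N x y w<N x≡y (p^w∣x , p^[w+1]∤x) =
    ^-∣-transfer w N x y (<⇒≤ w<N) x≡y p^w∣x ,
    λ p^[w+1]∣y → p^[w+1]∤x (^-∣-transfer (suc w) N y x w<N (∣-diff-sym (+ (p ^ N)) x y x≡y) p^[w+1]∣y)

  ^-∣-* : ∀ a b x y → + (p ^ a) ∣ x → + (p ^ b) ∣ y → + (p ^ (a + b)) ∣ x ℤ.* y
  ^-∣-* a b x y p^a∣x p^b∣y =
    subst₂ _∣ℕ_ (sym (^-distribˡ-+-* p a b)) (sym (ℤP.abs-* x y)) (*-pres-∣ p^a∣x p^b∣y)

  val-*ℤ : ∀ v w x y → IsValℤ x v → IsValℤ y w → IsValℤ (x ℤ.* y) (v + w)
  val-*ℤ v w x y x-val y-val = subst (λ z → IsVal p z (v + w)) (sym (ℤP.abs-* x y)) (val-* v w x-val y-val)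

  left-block : ∀ M n j → + (p ^ M) ∣ n - + j → + (p ^ M) ∣ + (j !) - falling n j
  left-block M n j n≡j =
    ∣-diff-sym (+ (p ^ M)) (falling n j) (+ (j !))
      (subst (λ z → + (p ^ M) ∣ falling n j - z) (falling-self j) (falling-cong (+ (p ^ M)) n (+ j) j n≡j))

  right-block : ∀ M n j r → + (p ^ M) ∣ n - + j →
                + (p ^ M) ∣ falling -[1+ 0 ] r - falling ((n - + j) - + 1) r
  right-block M n j r n≡j =
    ∣-diff-sym (+ (p ^ M)) (falling ((n - + j) - + 1) r) (falling -[1+ 0 ] r)
      (falling-cong (+ (p ^ M)) ((n - + j) - + 1) -[1+ 0 ] r (subst (+ (p ^ M) ∣_) (sym (shift (n - + j))) n≡j))
    where
    shift : ∀ x → (x - + 1) - ℤ.- (+ 1) ≡ x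
    shift = ℤ-Ring.solve-∀

  falling-near-root-∣ : ∀ M w₁ w₂ n j r → w₁ ≤ M → w₂ ≤ M → IsVal p (j !) w₁ → IsVal p (r !) w₂ →
                        + (p ^ M) ∣ n - + j → + (p ^ (w₁ + (M + w₂))) ∣ falling n (j + suc r)
  falling-near-root-∣ M w₁ w₂ n j r w₁≤M w₂≤M j!-val r!-val n≡j =
    subst (+ (p ^ (w₁ + (M + w₂))) ∣_) (sym (falling-around n j r))
      (^-∣-* w₁ (M + w₂) (falling n j) _ left (^-∣-* M w₂ (n - + j) (falling n′ r) n≡j right))
    where
    n′ = (n - + j) - + 1
    left : + (p ^ w₁) ∣ falling n j
    left = ^-∣-transfer w₁ M (+ (j !)) (falling n j) w₁≤M (left-block M n j n≡j) (proj₁ j!-val)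
    right : + (p ^ w₂) ∣ falling n′ r
    right = ^-∣-transfer w₂ M (falling -[1+ 0 ] r) (falling n′ r) w₂≤M (right-block M n j r n≡j)
              (subst (p ^ w₂ ∣ℕ_) (sym (falling-minus-one r)) (proj₁ r!-val))

  falling-near-root-val : ∀ N w₁ w₂ n j r → w₁ < N → w₂ < N → IsVal p (j !) w₁ → IsVal p (r !) w₂ →
                          IsValℤ (n - + j) N → IsValℤ (falling n (j + suc r)) (w₁ + (N + w₂))
  falling-near-root-val N w₁ w₂ n j r w₁<N w₂<N j!-val r!-val n-j-val =
    subst (λ z → IsValℤ z (w₁ + (N + w₂))) (sym (falling-around n j r))
      (val-*ℤ w₁ (N + w₂) (falling n j) _ left (val-*ℤ N w₂ (n - + j) (falling n′ r) n-j-val right))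
    where
    n′ = (n - + j) - + 1
    n≡j : + (p ^ N) ∣ n - + j
    n≡j = proj₁ n-j-val
    left : IsValℤ (falling n j) w₁
    left = val-transfer w₁ N (+ (j !)) (falling n j) w₁<N (left-block N n j n≡j) j!-val
    right : IsValℤ (falling n′ r) w₂
    right = val-transfer w₂ N (falling -[1+ 0 ] r) (falling n′ r) w₂<N (right-block N n j r n≡j)
              (subst (λ z → IsVal p z w₂) (sym (falling-minus-one r)) r!-val)

  -- If n ≡ n' (mod p^M) and no factor n - j of (n)_m is divisible by p^M,
  -- each factor has valuation below M, shared with n' - j; hence (n)_m and
  -- (n')_m have the same valuation.
  falling-far-from-roots : ∀ M n n' m → + (p ^ M) ∣ n - n' → (∀ {j} → j < m → ¬ + (p ^ M) ∣ n - + j) →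
                           ∃[ w ] (IsValℤ (falling n m) w × IsValℤ (falling n' m) w)
  falling-far-from-roots M n n' zero _ _ = 0 , val-one , val-one
  falling-far-from-roots M n n' (suc m) n≡n' far
    with falling-far-from-roots M n n' m n≡n' (λ j<m → far (m≤n⇒m≤1+n j<m))
       | val-below M ∣ n - + m ∣ (far ≤-refl)
  ... | w , n-val , n'-val | v , v<M , v-val =
    w + v , val-*ℤ w v (falling n m) (n - + m) n-val v-val ,
            val-*ℤ w v (falling n' m) (n' - + m) n'-val (val-transfer v M (n - + m) (n' - + m) v<M shifted v-val)
    where
    cancel : ∀ x y c → (x - c) - (y - c) ≡ x - y
    cancel = ℤ-Ring.solve-∀
    shifted : + (p ^ M) ∣ (n - + m) - (n' - + m)
    shifted = subst (+ (p ^ M) ∣_) (sym (cancel n n' (+ m))) n≡n'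

  -- If n ≡ j (mod p^{e+L}) for some j < k, then p^{2e} ∣ (n)_k: writing
  -- k = j + 1 + r, the bound above gives ν ≥ ν(j!) + e + L + ν(r!), and
  -- subadditivity of Legendre's sum gives e ≤ L + ν(j!) + ν(r!).
  cond-near-root : ∀ k e L → IsEp p k e → k < p ^ suc L →
                   ∀ n {j} → j < k → + (p ^ (e + L)) ∣ n - + j → Cond p k e n
  cond-near-root k e L e-val k<p^[L+1] n {j} j<k n≡j =
    ^-∣-weaken p 2e≤bound
      (subst (λ z → + (p ^ (w₁ + (e + L + w₂))) ∣ falling n z) k≡
        (falling-near-root-∣ (e + L) w₁ w₂ n j r w₁≤e+L w₂≤e+L j!-val r!-val n≡j))
    where
    r = k ∸ suc j
    k≡ : j + suc r ≡ k
    k≡ = trans (+-suc j r) (m+[n∸m]≡n j<k)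
    w₁ = legendre L j
    w₂ = legendre L r
    j!-val : IsVal p (j !) w₁
    j!-val = legendre-formula L j (<-trans j<k k<p^[L+1])
    r!-val : IsVal p (r !) w₂
    r!-val = legendre-formula L r (≤-<-trans (m∸n≤m k (suc j)) k<p^[L+1])
    e≡ : e ≡ legendre L k
    e≡ = val-unique e-val (legendre-formula L k k<p^[L+1])
    below-e : ∀ {i} → i ≤ k → legendre L i ≤ e + L
    below-e i≤k = ≤-trans (legendre-mono L i≤k) (≤-trans (≤-reflexive (sym e≡)) (m≤m+n e L))
    w₁≤e+L : w₁ ≤ e + L
    w₁≤e+L = below-e (<⇒≤ j<k)
    w₂≤e+L : w₂ ≤ e + L
    w₂≤e+L = below-e (m∸n≤m k (suc j))
    e≤ : e ≤ L + w₁ + w₂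
    e≤ = subst (_≤ L + w₁ + w₂) (trans (cong (legendre L) (trans (sym (+-suc j r)) k≡)) (sym e≡))
           (legendre-subadditive L j r)
    regroup : ∀ e L w₁ w₂ → e + (L + w₁ + w₂) ≡ w₁ + (e + L + w₂)
    regroup = ℕ-Ring.solve-∀
    2e≤bound : 2 * e ≤ w₁ + (e + L + w₂)
    2e≤bound = begin
      2 * e                  ≡⟨ cong (λ z → e + z) (+-identityʳ e) ⟩
      e + e                  ≤⟨ +-monoʳ-≤ e e≤ ⟩
      e + (L + w₁ + w₂)      ≡⟨ regroup e L w₁ w₂ ⟩
      w₁ + (e + L + w₂)      ∎
      where open ≤-Reasoning

  depends-mod-p^[e+L] : ∀ k e L → IsEp p k e → k < p ^ suc L → DependsOnlyMod p k e (e + L)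
  depends-mod-p^[e+L] k e L e-val k<p^[L+1] n n' n≡n'
    with anyUpTo? (λ j → p ^ (e + L) ∣? ∣ n - + j ∣) k
  ... | yes (j , j<k , n≡j) =
    mk⇔ (λ _ → cond-near-root k e L e-val k<p^[L+1] n' j<k n'≡j) (λ _ → cond-near-root k e L e-val k<p^[L+1] n j<k n≡j)
    where
    n'≡j : + (p ^ (e + L)) ∣ n' - + j
    n'≡j = ∣-diff-trans (+ (p ^ (e + L))) n' n (+ j) (∣-diff-sym (+ (p ^ (e + L))) n n' n≡n') n≡j
  ... | no no-root with falling-far-from-roots (e + L) n n' k n≡n' (λ j<k n≡j → no-root (_ , j<k , n≡j))
  ...   | w , n-val , n'-val = mk⇔ (val-same-∣ w (2 * e) n-val n'-val) (val-same-∣ w (2 * e) n'-val n-val)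

  -- Put
  -- j₀ = p^L - 1, k = j₀ + 1 + r₀ and N = e + L - 1.  Then (j₀)_k = 0 meets
  -- the condition while n = j₀ + p^N ≡ j₀ (mod p^N) does not.

  split-at-p^L : ∀ {k} L → p ^ L ≤ k → pred (p ^ L) + suc (k ∸ p ^ L) ≡ k
  split-at-p^L {k} L p^L≤k =
    trans (+-suc (pred (p ^ L)) (k ∸ p ^ L)) (trans (cong (_+ (k ∸ p ^ L)) (suc-pred (p ^ L) {{m^n≢0 p L}})) (m+[n∸m]≡n p^L≤k))

  -- n = j₀ + p^N fails the condition: by legendre-pow, e = L + ν(j₀!) + ν(r₀!),
  -- so ν((n)_k) = ν(j₀!) + N + ν(r₀!) = 2e - 1.
  shifted-root-fails : ∀ k e L′ → IsEp p k e → IsFloorLog p k (suc L′) →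
                       ¬ Cond p k e (+ pred (p ^ suc L′) ℤ.+ + (p ^ (e + L′)))
  shifted-root-fails k e L′ e-val (p^L≤k , k<p^[L+1]) cond = <⇒≱ (≤-reflexive one-short) (val-≥ n-val cond)
    where
    L = suc L′
    j₀ = pred (p ^ L)
    r₀ = k ∸ p ^ L
    w₁ = legendre L j₀
    w₂ = legendre L r₀
    N = e + L′
    n = + j₀ ℤ.+ + (p ^ N)
    e≡ : e ≡ suc (L′ + w₁ + w₂)
    e≡ = trans (val-unique e-val (legendre-formula L k k<p^[L+1]))
               (trans (cong (legendre L) (sym (m+[n∸m]≡n p^L≤k))) (legendre-pow L r₀))
    e≤N : e ≤ N
    e≤N = m≤m+n e L′
    w₁<N : w₁ < N
    w₁<N = ≤-trans (s≤s (≤-trans (m≤n+m w₁ L′) (m≤m+n (L′ + w₁) w₂))) (subst (_≤ N) e≡ e≤N)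
    w₂<N : w₂ < N
    w₂<N = ≤-trans (s≤s (m≤n+m w₂ (L′ + w₁))) (subst (_≤ N) e≡ e≤N)
    n-j₀≡p^N : n - + j₀ ≡ + (p ^ N)
    n-j₀≡p^N = [a+b]-a≡b (+ j₀) (+ (p ^ N))
    n-val : IsValℤ (falling n k) (w₁ + (N + w₂))
    n-val = subst (λ z → IsValℤ (falling n z) (w₁ + (N + w₂))) (split-at-p^L L p^L≤k)
      (falling-near-root-val N w₁ w₂ n j₀ r₀ w₁<N w₂<N
        (legendre-formula L j₀ (≤-<-trans pred[n]≤n (≤-<-trans p^L≤k k<p^[L+1])))
        (legendre-formula L r₀ (≤-<-trans (m∸n≤m k (p ^ L)) k<p^[L+1]))
        (subst (λ z → IsValℤ z N) (sym n-j₀≡p^N) (val-pow N)))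
    identity : ∀ L′ w₁ w₂ → suc (w₁ + (suc (L′ + w₁ + w₂) + L′ + w₂)) ≡ 2 * suc (L′ + w₁ + w₂)
    identity = ℕ-Ring.solve-∀
    one-short : suc (w₁ + (N + w₂)) ≡ 2 * e
    one-short = subst (λ e → suc (w₁ + (e + L′ + w₂)) ≡ 2 * e) (sym e≡) (identity L′ w₁ w₂)

  -- The case L = 0 cannot occur, as p ≤ k < p^1.
  not-depends-below : ∀ k e L → p ≤ k → IsEp p k e → IsFloorLog p k L →
                      ∀ m → m < e + L → ¬ DependsOnlyMod p k e m
  not-depends-below k e zero p≤k _ (_ , k<p) _ _ _ = <⇒≱ k<p (subst (_≤ k) (sym (*-identityʳ p)) p≤k)
  not-depends-below k e (suc L′) p≤k e-val floor-log@(p^L≤k , _) m m<e+L depends =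
    shifted-root-fails k e L′ e-val floor-log (Equivalence.from (depends n (+ j₀) n≡j₀) condition-at-root)
    where
    j₀ = pred (p ^ suc L′)
    N = e + L′
    n = + j₀ ℤ.+ + (p ^ N)
    condition-at-root : Cond p k e (+ j₀)
    condition-at-root = subst (λ z → p ^ (2 * e) ∣ℕ ∣ falling (+ j₀) z ∣) (split-at-p^L (suc L′) p^L≤k)
                          (subst (λ z → p ^ (2 * e) ∣ℕ ∣ z ∣) (sym (falling-root j₀ (k ∸ p ^ suc L′))) ((p ^ (2 * e)) ∣0))
    n≡j₀ : n ≡[mod p ^ m ] (+ j₀)
    n≡j₀ = ^-∣-weaken p (≤-pred (subst (suc m ≤_) (+-suc e L′) m<e+L))
             (subst (λ z → p ^ N ∣ℕ ∣ z ∣) (sym ([a+b]-a≡b (+ j₀) (+ (p ^ N)))) ∣-refl)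

theorem2 : ∀ (k p : ℕ) → 1 ≤ k → Prime p → p ≤ k →
           ∀ (e L : ℕ) → IsEp p k e → IsFloorLog p k L →
           IsAp p k e (e + L)
theorem2 k p _ p-prime p≤k e L e-val floor-log@(_ , k<p^[L+1]) =
  depends-mod-p^[e+L] k e L e-val k<p^[L+1] , not-depends-below k e L p≤k e-val floor-log
  where open PrimeValuation p-prime
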